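{- Let $\Pi$ be a finite projective plane and $S=\mathcal{P}_S\cup\mathcal{L}_S$ with $\mathcal{P}_S$ a set of points and $\mathcal{L}_S$ a set of lines. Then $S$ is a resolving set of the incidence graph of $\Pi$ if and only if: (PA) through every point $P$ there is at most one line not in $\mathcal{L}_S$ that contains no point of $\mathcal{P}_S\setminus\{P\}$; and (PA') on every line $\ell$ there is at most one point not in $\mathcal{P}_S$ that lies on no line of $\mathcal{L}_S\setminus\{\ell\}$.
   Context: The incidence graph of $\Pi$ is the bipartite graph on points and lines with adjacency given by incidence. A set of vertices is resolving if the ordered distance lists of all vertices with respect to it are pairwise distinct. -}

module Defs where

open import Data.Nat using (ℕ; zero; suc; _≤_)
open import Data.Fin using (Fin)
open import Data.Fin.Subset using (Subset; _∈_; _∉_)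
open import Data.Sum using (_⊎_; inj₁; inj₂)
open import Data.Product using (Σ; ∃; _×_; _,_)
open import Data.Empty using (⊥)
open import Relation.Nullary using (¬_)
open import Relation.Binary.PropositionalEquality using (_≡_; _≢_)
open import Function.Bundles using (_⇔_)

record ProjectivePlane : Set₁ where
  field
    np nl : ℕ
    _I_ : Fin np → Fin nl → Set
    join : ∀ (P Q : Fin np) → P ≢ Q →
           Σ (Fin nl) λ ℓ → (P I ℓ) × (Q I ℓ) ×
             (∀ m → P I m → Q I m → m ≡ ℓ)
    meet : ∀ (ℓ m : Fin nl) → ℓ ≢ m →
           Σ (Fin np) λ P → (P I ℓ) × (P I m) ×
             (∀ Q → Q I ℓ → Q I m → Q ≡ P)
    quad : Σ (Fin np) λ A → Σ (Fin np) λ B → Σ (Fin np) λ C → Σ (Fin np) λ D →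
           (A ≢ B) × (A ≢ C) × (A ≢ D) × (B ≢ C) × (B ≢ D) × (C ≢ D) ×
           (∀ ℓ → ¬ ((A I ℓ) × (B I ℓ) × (C I ℓ))) ×
           (∀ ℓ → ¬ ((A I ℓ) × (B I ℓ) × (D I ℓ))) ×
           (∀ ℓ → ¬ ((A I ℓ) × (C I ℓ) × (D I ℓ))) ×
           (∀ ℓ → ¬ ((B I ℓ) × (C I ℓ) × (D I ℓ)))

module _ (Π : ProjectivePlane) where
  open ProjectivePlane Π

  Vertex : Set
  Vertex = Fin np ⊎ Fin nl

  Adj : Vertex → Vertex → Set
  Adj (inj₁ P) (inj₂ ℓ) = P I ℓ
  Adj (inj₂ ℓ) (inj₁ P) = P I ℓ
  Adj (inj₁ _) (inj₁ _) = ⊥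
  Adj (inj₂ _) (inj₂ _) = ⊥

  data Walk : Vertex → Vertex → ℕ → Set where
    here : ∀ {u} → Walk u u zero
    step : ∀ {u v w n} → Adj u v → Walk v w n → Walk u w (suc n)

  IsDist : Vertex → Vertex → ℕ → Set
  IsDist u v d = Walk u v d × (∀ m → Walk u v m → d ≤ m)

  InS : Subset np → Subset nl → Vertex → Set
  InS PS LS (inj₁ P) = P ∈ PS
  InS PS LS (inj₂ ℓ) = ℓ ∈ LS

  Resolving : Subset np → Subset nl → Set
  Resolving PS LS = ∀ (u v : Vertex) →
    (∀ s → InS PS LS s → ∀ d → (IsDist u s d ⇔ IsDist v s d)) → u ≡ v

  CondPA : Subset np → Subset nl → Set
  CondPA PS LS = ∀ (P : Fin np) (ℓ m : Fin nl) →
    P I ℓ → ℓ ∉ LS → (∀ Q → Q ∈ PS → Q ≢ P → ¬ (Q I ℓ)) →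
    P I m → m ∉ LS → (∀ Q → Q ∈ PS → Q ≢ P → ¬ (Q I m)) →
    ℓ ≡ m

  CondPA' : Subset np → Subset nl → Set
  CondPA' PS LS = ∀ (ℓ : Fin nl) (P Q : Fin np) →
    P I ℓ → P ∉ PS → (∀ m → m ∈ LS → m ≢ ℓ → ¬ (P I m)) →
    Q I ℓ → Q ∉ PS → (∀ m → m ∈ LS → m ≢ ℓ → ¬ (Q I m)) →
    P ≡ Q

-- Distances in the incidence graph of a projective plane are forced by
-- incidence: 0 to itself, 1 to an incident element, 2 to another element of
-- the same kind, 3 to a non-incident element of the other kind.  Hence two
-- distinct points P, Q are told apart by S exactly when some point of S is P
-- or Q, or some line of S other than PQ passes through P or Q; so S resolves
-- all pairs of points iff (PA') holds, and dually for lines and (PA).  A point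
-- and a line are never confused unless S is empty, since distances from a
-- point and from a line to a fixed vertex have different parities; and the
-- empty set violates (PA') on the line through two points of the plane.
module Submission where

open import Defs
open import Data.Fin.Subset using (Subset)
open import Data.Product using (_×_)
open import Function.Bundles using (_⇔_)

open import Data.Bool using (Bool; true; false; not)
open import Data.Bool.Properties using (not-¬; not-involutive)
open import Data.Empty using (⊥; ⊥-elim)
open import Data.Fin using (_≟_)
open import Data.Fin.Subset using (_∈_; _∉_)
open import Data.Nat using (ℕ; zero; suc; _≤_; z≤n; s≤s)
open import Data.Nat.Properties using (≤-antisym)
open import Data.Product using (Σ; _,_; proj₁)
open import Data.Sum using (inj₁; inj₂)
open import Data.Sum.Properties using (inj₁-injective; inj₂-injective)
open import Function.Base using (_∘_)
open import Function.Bundles using (mk⇔; Equivalence)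
open import Function.Properties.Equivalence using () renaming (sym to ⇔-sym)
open import Relation.Nullary using (¬_; yes; no)
open import Relation.Binary.PropositionalEquality

module _ (Π : ProjectivePlane) where
  open ProjectivePlane Π

  isPoint : Vertex Π → Bool
  isPoint (inj₁ _) = true
  isPoint (inj₂ _) = false

  flipped : ℕ → Bool → Bool
  flipped zero    b = b
  flipped (suc n) b = not (flipped n b)

  Adj⇒opposite : ∀ {u v} → Adj Π u v → isPoint u ≡ not (isPoint v)
  Adj⇒opposite {inj₁ _} {inj₂ _} _ = refl
  Adj⇒opposite {inj₂ _} {inj₁ _} _ = refl

  walk-parity : ∀ {u v n} → Walk Π u v n → isPoint u ≡ flipped n (isPoint v)
  walk-parity here       = refl
  walk-parity (step a w) = trans (Adj⇒opposite a) (cong not (walk-parity w))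

  walks-of-equal-length⇒same-kind : ∀ {u v s n} →
    Walk Π u s n → Walk Π v s n → isPoint u ≡ isPoint v
  walks-of-equal-length⇒same-kind wu wv = trans (walk-parity wu) (sym (walk-parity wv))

  walk₀⇒≡ : ∀ {u v} → Walk Π u v 0 → u ≡ v
  walk₀⇒≡ here = refl

  ¬Adj-refl : ∀ u → ¬ Adj Π u u
  ¬Adj-refl (inj₁ _) ()
  ¬Adj-refl (inj₂ _) ()

  IsDist-unique : ∀ {u v c d} → IsDist Π u v c → IsDist Π u v d → c ≡ d
  IsDist-unique (wc , minc) (wd , mind) = ≤-antisym (minc _ wd) (mind _ wc)

  dist-refl : ∀ {u} → IsDist Π u u 0
  dist-refl = here , λ _ _ → z≤n

  dist-adjacent : ∀ {u v} → Adj Π u v → IsDist Π u v 1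
  dist-adjacent {u} a = step a here , minimal
    where
    minimal : ∀ m → Walk Π u _ m → 1 ≤ m
    minimal zero    w = ⊥-elim (¬Adj-refl u (subst (Adj Π u) (sym (walk₀⇒≡ w)) a))
    minimal (suc m) _ = s≤s z≤n

  dist₁⇒Adj : ∀ {u v} → IsDist Π u v 1 → Adj Π u v
  dist₁⇒Adj (step a here , _) = a

  dist-same-kind : ∀ {u v} → isPoint u ≡ isPoint v → u ≢ v → Walk Π u v 2 → IsDist Π u v 2
  dist-same-kind {u} {v} same u≢v w = w , minimal
    where
    minimal : ∀ m → Walk Π u v m → 2 ≤ m
    minimal zero          w₀ = ⊥-elim (u≢v (walk₀⇒≡ w₀))
    minimal (suc zero)    w₁ = ⊥-elim (not-¬ same (walk-parity w₁))
    minimal (suc (suc m)) _  = s≤s (s≤s z≤n)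

  dist-other-kind : ∀ {u v} → isPoint u ≡ not (isPoint v) → ¬ Adj Π u v →
    Walk Π u v 3 → IsDist Π u v 3
  dist-other-kind {u} {v} opposite ¬adj w = w , minimal
    where
    minimal : ∀ m → Walk Π u v m → 3 ≤ m
    minimal zero                w₀ = ⊥-elim (not-¬ (cong isPoint (walk₀⇒≡ w₀)) opposite)
    minimal (suc zero)          (step a here) = ⊥-elim (¬adj a)
    minimal (suc (suc zero))    w₂ =
      ⊥-elim (not-¬ (trans (walk-parity w₂) (not-involutive _)) opposite)
    minimal (suc (suc (suc m))) _  = s≤s (s≤s (s≤s z≤n))

  dist-distinct-points : ∀ {P Q} → P ≢ Q → IsDist Π (inj₁ P) (inj₁ Q) 2
  dist-distinct-points {P} {Q} P≢Q with join P Q P≢Q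
  ... | ℓ , Pℓ , Qℓ , _ =
    dist-same-kind refl (P≢Q ∘ inj₁-injective) (step {v = inj₂ ℓ} Pℓ (step {v = inj₁ Q} Qℓ here))

  dist-distinct-lines : ∀ {ℓ m} → ℓ ≢ m → IsDist Π (inj₂ ℓ) (inj₂ m) 2
  dist-distinct-lines {ℓ} {m} ℓ≢m with meet ℓ m ℓ≢m
  ... | R , Rℓ , Rm , _ =
    dist-same-kind refl (ℓ≢m ∘ inj₂-injective) (step {v = inj₁ R} Rℓ (step {v = inj₂ m} Rm here))

  dist-nonincident-point : ∀ {P Q m} → ¬ P I m → Q I m → IsDist Π (inj₁ P) (inj₂ m) 3
  dist-nonincident-point {P} {Q} {m} P∉m Qm with join P Q (λ { refl → P∉m Qm })
  ... | ℓ , Pℓ , Qℓ , _ =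
    dist-other-kind refl P∉m
      (step {v = inj₂ ℓ} Pℓ (step {v = inj₁ Q} Qℓ (step {v = inj₂ m} Qm here)))

  dist-nonincident-line : ∀ {ℓ P R} → ¬ R I ℓ → P I ℓ → IsDist Π (inj₂ ℓ) (inj₁ R) 3
  dist-nonincident-line {ℓ} {P} {R} R∉ℓ Pℓ with join P R (λ { refl → R∉ℓ Pℓ })
  ... | k , Pk , Rk , _ =
    dist-other-kind refl R∉ℓ
      (step {v = inj₁ P} Pℓ (step {v = inj₂ k} Pk (step {v = inj₁ R} Rk here)))

  point-distance : ∀ P R → Σ ℕ (IsDist Π (inj₁ P) (inj₁ R))
  point-distance P R with P ≟ R
  ... | yes refl = 0 , dist-refl
  ... | no P≢R   = 2 , dist-distinct-points P≢R

  line-distance : ∀ ℓ n → Σ ℕ (IsDist Π (inj₂ ℓ) (inj₂ n))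
  line-distance ℓ n with ℓ ≟ n
  ... | yes refl = 0 , dist-refl
  ... | no ℓ≢n   = 2 , dist-distinct-lines ℓ≢n

  point-and-line-distances-differ : ∀ {P ℓ s d} →
    IsDist Π (inj₁ P) s d → IsDist Π (inj₂ ℓ) s d → ⊥
  point-and-line-distances-differ (wP , _) (wℓ , _)
    with walks-of-equal-length⇒same-kind wP wℓ
  ... | ()

module _ (Π : ProjectivePlane)
         (PS : Subset (ProjectivePlane.np Π)) (LS : Subset (ProjectivePlane.nl Π)) where
  open ProjectivePlane Π
  open Equivalence

  Indistinguishable : Vertex Π → Vertex Π → Set
  Indistinguishable u v = ∀ s → InS Π PS LS s → ∀ d → (IsDist Π u s d ⇔ IsDist Π v s d)

  indistinguishable-sym : ∀ {u v} → Indistinguishable u v → Indistinguishable v u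
  indistinguishable-sym h s s∈S d = ⇔-sym (h s s∈S d)

  equal-distances : ∀ {u v s c} → IsDist Π u s c → IsDist Π v s c →
    ∀ d → (IsDist Π u s d ⇔ IsDist Π v s d)
  equal-distances du dv d =
    mk⇔ (λ du′ → subst (IsDist Π _ _) (IsDist-unique Π du du′) dv)
        (λ dv′ → subst (IsDist Π _ _) (IsDist-unique Π dv dv′) du)

  indistinguishable-member⇒≡ : ∀ {u v} → Indistinguishable u v → InS Π PS LS u → v ≡ u
  indistinguishable-member⇒≡ {u} h u∈S = walk₀⇒≡ Π (proj₁ (to (h u u∈S 0) (dist-refl Π)))

  indistinguishable-adjacent : ∀ {u v} → Indistinguishable u v →
    ∀ s → InS Π PS LS s → Adj Π u s → Adj Π v s
  indistinguishable-adjacent h s s∈S a = dist₁⇒Adj Π (to (h s s∈S 1) (dist-adjacent Π a))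

  resolving⇒PA' : Resolving Π PS LS → CondPA' Π PS LS
  resolving⇒PA' resolving ℓ P Q Pℓ P∉ P-off Qℓ Q∉ Q-off =
    inj₁-injective (resolving (inj₁ P) (inj₁ Q) h)
    where
    h : Indistinguishable (inj₁ P) (inj₁ Q)
    h (inj₁ R) R∈ = equal-distances (dist-distinct-points Π (λ { refl → P∉ R∈ }))
                                    (dist-distinct-points Π (λ { refl → Q∉ R∈ }))
    h (inj₂ m) m∈ with m ≟ ℓ
    ... | yes refl = equal-distances (dist-adjacent Π Pℓ) (dist-adjacent Π Qℓ)
    ... | no m≢ℓ with meet ℓ m (m≢ℓ ∘ sym)
    ... | R , _ , Rm , _ = equal-distances (dist-nonincident-point Π (P-off m m∈ m≢ℓ) Rm)
                                           (dist-nonincident-point Π (Q-off m m∈ m≢ℓ) Rm)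

  resolving⇒PA : Resolving Π PS LS → CondPA Π PS LS
  resolving⇒PA resolving P ℓ m Pℓ ℓ∉ ℓ-off Pm m∉ m-off =
    inj₂-injective (resolving (inj₂ ℓ) (inj₂ m) h)
    where
    h : Indistinguishable (inj₂ ℓ) (inj₂ m)
    h (inj₂ n) n∈ = equal-distances (dist-distinct-lines Π (λ { refl → ℓ∉ n∈ }))
                                    (dist-distinct-lines Π (λ { refl → m∉ n∈ }))
    h (inj₁ R) R∈ with R ≟ P
    ... | yes refl = equal-distances (dist-adjacent Π Pℓ) (dist-adjacent Π Pm)
    ... | no R≢P = equal-distances (dist-nonincident-line Π (ℓ-off R R∈ R≢P) Pℓ)
                                   (dist-nonincident-line Π (m-off R R∈ R≢P) Pm)

  PA'⇒points-resolved : CondPA' Π PS LS → ∀ {P Q} → Indistinguishable (inj₁ P) (inj₁ Q) → P ≡ Q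
  PA'⇒points-resolved pa' {P} {Q} h with P ≟ Q
  ... | yes P≡Q = P≡Q
  ... | no P≢Q with join P Q P≢Q
  ... | ℓ , Pℓ , Qℓ , unique = pa' ℓ P Q Pℓ P∉ P-off Qℓ Q∉ Q-off
    where
    P∉ : P ∉ PS
    P∉ P∈ = P≢Q (sym (inj₁-injective (indistinguishable-member⇒≡ h P∈)))
    Q∉ : Q ∉ PS
    Q∉ Q∈ = P≢Q (inj₁-injective (indistinguishable-member⇒≡ (indistinguishable-sym h) Q∈))
    P-off : ∀ n → n ∈ LS → n ≢ ℓ → ¬ (P I n)
    P-off n n∈ n≢ℓ Pn = n≢ℓ (unique n Pn (indistinguishable-adjacent h (inj₂ n) n∈ Pn))
    Q-off : ∀ n → n ∈ LS → n ≢ ℓ → ¬ (Q I n)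
    Q-off n n∈ n≢ℓ Qn =
      n≢ℓ (unique n (indistinguishable-adjacent (indistinguishable-sym h) (inj₂ n) n∈ Qn) Qn)

  PA⇒lines-resolved : CondPA Π PS LS → ∀ {ℓ m} → Indistinguishable (inj₂ ℓ) (inj₂ m) → ℓ ≡ m
  PA⇒lines-resolved pa {ℓ} {m} h with ℓ ≟ m
  ... | yes ℓ≡m = ℓ≡m
  ... | no ℓ≢m with meet ℓ m ℓ≢m
  ... | P , Pℓ , Pm , unique = pa P ℓ m Pℓ ℓ∉ ℓ-off Pm m∉ m-off
    where
    ℓ∉ : ℓ ∉ LS
    ℓ∉ ℓ∈ = ℓ≢m (sym (inj₂-injective (indistinguishable-member⇒≡ h ℓ∈)))
    m∉ : m ∉ LS
    m∉ m∈ = ℓ≢m (inj₂-injective (indistinguishable-member⇒≡ (indistinguishable-sym h) m∈))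
    ℓ-off : ∀ R → R ∈ PS → R ≢ P → ¬ (R I ℓ)
    ℓ-off R R∈ R≢P Rℓ = R≢P (unique R Rℓ (indistinguishable-adjacent h (inj₁ R) R∈ Rℓ))
    m-off : ∀ R → R ∈ PS → R ≢ P → ¬ (R I m)
    m-off R R∈ R≢P Rm =
      R≢P (unique R (indistinguishable-adjacent (indistinguishable-sym h) (inj₁ R) R∈ Rm) Rm)

  point-line-indistinguishable⇒S-empty : ∀ {P ℓ} → Indistinguishable (inj₁ P) (inj₂ ℓ) →
    ∀ s → ¬ InS Π PS LS s
  point-line-indistinguishable⇒S-empty {P} h (inj₁ R) R∈ =
    let d , dP = point-distance Π P R
    in point-and-line-distances-differ Π dP (to (h (inj₁ R) R∈ d) dP)
  point-line-indistinguishable⇒S-empty {ℓ = ℓ} h (inj₂ n) n∈ =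
    let d , dℓ = line-distance Π ℓ n
    in point-and-line-distances-differ Π (from (h (inj₂ n) n∈ d) dℓ) dℓ

  S-empty⇒¬PA' : (∀ s → ¬ InS Π PS LS s) → ¬ CondPA' Π PS LS
  S-empty⇒¬PA' empty pa' with quad
  ... | A , B , _ , _ , A≢B , _ with join A B A≢B
  ... | k , Ak , Bk , _ = A≢B (pa' k A B Ak (empty (inj₁ A)) off Bk (empty (inj₁ B)) off)
    where
    off : ∀ {X} n → n ∈ LS → n ≢ k → ¬ (X I n)
    off n n∈ _ _ = empty (inj₂ n) n∈

  PA×PA'⇒resolving : CondPA Π PS LS × CondPA' Π PS LS → Resolving Π PS LS
  PA×PA'⇒resolving (pa , pa') (inj₁ P) (inj₁ Q) h = cong inj₁ (PA'⇒points-resolved pa' h)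
  PA×PA'⇒resolving (pa , pa') (inj₂ ℓ) (inj₂ m) h = cong inj₂ (PA⇒lines-resolved pa h)
  PA×PA'⇒resolving (pa , pa') (inj₁ P) (inj₂ ℓ) h =
    ⊥-elim (S-empty⇒¬PA' (point-line-indistinguishable⇒S-empty h) pa')
  PA×PA'⇒resolving (pa , pa') (inj₂ ℓ) (inj₁ P) h =
    ⊥-elim (S-empty⇒¬PA' (point-line-indistinguishable⇒S-empty (indistinguishable-sym h)) pa')

proposition2p2 : (Π : ProjectivePlane) →
    (PS : Subset (ProjectivePlane.np Π)) → (LS : Subset (ProjectivePlane.nl Π)) →
    Resolving Π PS LS ⇔ (CondPA Π PS LS × CondPA' Π PS LS)
proposition2p2 Π PS LS =
  mk⇔ (λ resolving → resolving⇒PA Π PS LS resolving , resolving⇒PA' Π PS LS resolving)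
      (PA×PA'⇒resolving Π PS LS)
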